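{- Let $\lambda\in\mathbb{R}$ and let $p$ be a positive integer. Define \[ y_{p,\lambda}(x)=\sum_{n=2}^{\infty}\Big((1)_{p,\lambda}+(2)_{p,\lambda}+\cdots+(n-1)_{p,\lambda}\Big)\frac{x^n}{n!}. \] Then $y_{p,\lambda}$ satisfies the differential equation \[ y_{p,\lambda}'(x)-y_{p,\lambda}(x)=e^{x}\phi_{p,\lambda}(x). \]
   Context: For $\lambda\in\mathbb{R}$, the generalized falling factorials are $(x)_{0,\lambda}=1$ and $(x)_{n,\lambda}=x(x-\lambda)(x-2\lambda)\cdots(x-(n-1)\lambda)$ for $n\ge 1$. The degenerate exponential is the formal power series $e_\lambda(t)=\sum_{n\ge 0}(1)_{n,\lambda}\frac{t^n}{n!}$. The degenerate Bell polynomials $\phi_{n,\lambda}(x)$ are defined by the generating function $e^{x(e_\lambda(t)-1)}=\sum_{n=0}^{\infty}\phi_{n,\lambda}(x)\frac{t^n}{n!}$ (as formal power series in $t$). -}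

module Defs where

open import Level using (Level)
open import Data.Nat using (ℕ; zero; suc; _∸_)
open import Algebra.Bundles using (CommutativeRing)

-- Everything is developed over an arbitrary commutative ring R in which every
-- positive integer is invertible (e.g. R = ℝ).  λ ranges over R.
-- Formal power series in one variable are coefficient sequences ℕ → R
-- (ordinary coefficients: f n is the coefficient of x^n).
module Series {c ℓ : Level} (R : CommutativeRing c ℓ)
              (inv : ℕ → CommutativeRing.Carrier R) where

  open CommutativeRing R

  fromℕ : ℕ → Carrier
  fromℕ zero    = 0#
  fromℕ (suc n) = 1# + fromℕ n

  InvertsPositive : Set ℓ
  InvertsPositive = ∀ (n : ℕ) → fromℕ (suc n) * inv n ≈ 1#

  fact : ℕ → Carrier
  fact zero    = 1#
  fact (suc n) = fromℕ (suc n) * fact n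

  invFact : ℕ → Carrier
  invFact zero    = 1#
  invFact (suc n) = inv n * invFact n

  sumTo : ℕ → (ℕ → Carrier) → Carrier
  sumTo zero    f = 0#
  sumTo (suc n) f = sumTo n f + f n

  -- generalized falling factorial (x)_{n,λ} = x (x-λ) ... (x-(n-1)λ)
  falling : Carrier → ℕ → Carrier → Carrier
  falling lam zero    x = 1#
  falling lam (suc n) x = falling lam n x * (x - fromℕ n * lam)

  Series : Set c
  Series = ℕ → Carrier

  _≋_ : Series → Series → Set ℓ
  f ≋ g = ∀ (n : ℕ) → f n ≈ g n

  infix 4 _≋_

  _⊕_ _⊖_ _⊛_ : Series → Series → Series
  (f ⊕ g) n = f n + g n
  (f ⊖ g) n = f n - g n
  (f ⊛ g) n = sumTo (suc n) (λ i → f i * g (n ∸ i))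

  oneS : Series
  oneS zero    = 1#
  oneS (suc n) = 0#

  _^S_ : Series → ℕ → Series
  f ^S zero    = oneS
  f ^S (suc k) = f ⊛ (f ^S k)

  deriv : Series → Series
  deriv f n = fromℕ (suc n) * f (suc n)

  expS : Series
  expS n = invFact n

  eλ' : Carrier → Series
  eλ' lam n = falling lam n 1# * invFact n

  eλm1 : Carrier → Series
  eλm1 lam = eλ' lam ⊖ oneS

  -- e^{x(e_λ(t)-1)} = Σ_k x^k (e_λ(t)-1)^k / k!  as a bivariate series:
  -- coefficient of x^k t^n
  genBell : Carrier → ℕ → ℕ → Carrier
  genBell lam k n = invFact k * ((eλm1 lam ^S k) n)

  -- degenerate Bell polynomial φ_{n,λ}(x) = n! [t^n] e^{x(e_λ(t)-1)},
  -- viewed as a power series in x (coefficient of x^k)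
  φ : Carrier → ℕ → Series
  φ lam n k = fact n * genBell lam k n

  y : Carrier → ℕ → Series
  y lam p zero          = 0#
  y lam p (suc zero)    = 0#
  y lam p (suc (suc m)) =
    sumTo (suc m) (λ j → falling lam p (fromℕ (suc j))) * invFact (suc (suc m))

{-# OPTIONS --safe #-}
-- Coefficientwise, the telescoping partial sums give [xⁿ](y′ − y) = (n)_{p,λ}/n!.
-- On the other side eˣ · e^{x(e_λ(t)−1)} = e^{x e_λ(t)}, whose xⁿ-coefficient is
-- e_λ(t)ⁿ/n! = e_λ^n(t)/n!, and [tᵖ] e_λ^n(t) = (n)_{p,λ}/p!.  Without exponentials of
-- series at hand, both facts are obtained from first-order recurrences: the
-- xⁿ-coefficients gₙ(t) of eˣ · e^{x(e_λ(t)−1)} satisfy (n+1) gₙ₊₁ = e_λ(t) gₙ, and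
-- e_λ^x(t) e_λ^y(t) = e_λ^{x+y}(t) because both sides have t-coefficients fₙ with
-- f₀ = 1 and (n+1) fₙ₊₁ = (x + y − nλ) fₙ.
module Submission where

open import Defs
open import Level using (Level)
open import Data.Nat using (ℕ; _≥_)
open import Algebra.Bundles using (CommutativeRing)

open import Data.Nat as Nat using (zero; suc; _∸_; _<_; _≤_; s≤s)
import Data.Nat.Properties as Natₚ
import Relation.Binary.PropositionalEquality as ≡

module _ {c ℓ : Level} (R : CommutativeRing c ℓ) (inv : ℕ → CommutativeRing.Carrier R) where

  open CommutativeRing R
  open Series R inv
  open import Relation.Binary.Reasoning.Setoid setoid
  open import Algebra.Properties.CommutativeSemigroup *-commutativeSemigroup
    using (x∙yz≈y∙xz; xy∙z≈y∙xz) renaming (interchange to *-interchange)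
  open import Algebra.Properties.CommutativeSemigroup +-commutativeSemigroup
    using () renaming (interchange to +-interchange)
  open import Algebra.Properties.AbelianGroup +-abelianGroup using (xyx⁻¹≈y; ⁻¹-∙-comm)

  [a+b][xy]≈[ax]y+x[by] : ∀ a b x y → (a + b) * (x * y) ≈ (a * x) * y + x * (b * y)
  [a+b][xy]≈[ax]y+x[by] a b x y =
    trans (distribʳ (x * y) a b) (+-cong (sym (*-assoc a x y)) (x∙yz≈y∙xz b x y))

  [x-al]+[y-bl]≈[x+y]-[a+b]l : ∀ x y a b l → (x - a * l) + (y - b * l) ≈ (x + y) - (a + b) * l
  [x-al]+[y-bl]≈[x+y]-[a+b]l x y a b l = begin
    (x - a * l) + (y - b * l)       ≈⟨ +-interchange x (- (a * l)) y (- (b * l)) ⟩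
    (x + y) + (- (a * l) - b * l)   ≈⟨ +-congˡ (⁻¹-∙-comm (a * l) (b * l)) ⟩
    (x + y) - (a * l + b * l)       ≈⟨ +-congˡ (-‿cong (sym (distribʳ l a b))) ⟩
    (x + y) - (a + b) * l           ∎

  sumTo-cong< : ∀ n {f g : ℕ → Carrier} → (∀ i → i < n → f i ≈ g i) → sumTo n f ≈ sumTo n g
  sumTo-cong< zero    f≈g = refl
  sumTo-cong< (suc n) f≈g =
    +-cong (sumTo-cong< n (λ i i<n → f≈g i (Natₚ.m<n⇒m<1+n i<n))) (f≈g n Natₚ.≤-refl)

  sumTo-cong : ∀ n {f g : ℕ → Carrier} → (∀ i → f i ≈ g i) → sumTo n f ≈ sumTo n g
  sumTo-cong n f≈g = sumTo-cong< n (λ i _ → f≈g i)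

  sumTo-zero : ∀ n {f : ℕ → Carrier} → (∀ i → f i ≈ 0#) → sumTo n f ≈ 0#
  sumTo-zero zero    f≈0 = refl
  sumTo-zero (suc n) f≈0 = trans (+-cong (sumTo-zero n f≈0) (f≈0 n)) (+-identityʳ 0#)

  sumTo-+ : ∀ n (f g : ℕ → Carrier) → sumTo n (λ i → f i + g i) ≈ sumTo n f + sumTo n g
  sumTo-+ zero    f g = sym (+-identityʳ 0#)
  sumTo-+ (suc n) f g = trans (+-congʳ (sumTo-+ n f g)) (+-interchange _ _ _ _)

  *-distribˡ-sumTo : ∀ n a (f : ℕ → Carrier) → a * sumTo n f ≈ sumTo n (λ i → a * f i)
  *-distribˡ-sumTo zero    a f = zeroʳ a
  *-distribˡ-sumTo (suc n) a f = trans (distribˡ a _ _) (+-congʳ (*-distribˡ-sumTo n a f))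

  sumTo-head : ∀ n (f : ℕ → Carrier) → sumTo (suc n) f ≈ f 0 + sumTo n (λ i → f (suc i))
  sumTo-head zero    f = trans (+-identityˡ (f 0)) (sym (+-identityʳ (f 0)))
  sumTo-head (suc n) f = trans (+-congʳ (sumTo-head n f)) (+-assoc _ _ _)

  sumTo-comm : ∀ m n (f : ℕ → ℕ → Carrier) →
               sumTo m (λ i → sumTo n (f i)) ≈ sumTo n (λ j → sumTo m (λ i → f i j))
  sumTo-comm zero    n f = sym (sumTo-zero n (λ _ → refl))
  sumTo-comm (suc m) n f = trans (+-congʳ (sumTo-comm m n f)) (sym (sumTo-+ n _ (f m)))

  fromℕ-+ : ∀ m n → fromℕ (m Nat.+ n) ≈ fromℕ m + fromℕ n
  fromℕ-+ zero    n = sym (+-identityˡ _)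
  fromℕ-+ (suc m) n = trans (+-congˡ (fromℕ-+ m n)) (sym (+-assoc _ _ _))

  fromℕ-split : ∀ {i n} → i ≤ n → fromℕ n ≈ fromℕ i + fromℕ (n ∸ i)
  fromℕ-split {i} {n} i≤n =
    trans (reflexive (≡.cong fromℕ (≡.sym (Natₚ.m+[n∸m]≡n i≤n)))) (fromℕ-+ i (n ∸ i))

  infixr 7 _·_
  _·_ : Carrier → Series → Series
  (a · f) n = a * f n

  ⊛-congˡ : ∀ {f f′ : Series} → f ≋ f′ → ∀ g → f ⊛ g ≋ f′ ⊛ g
  ⊛-congˡ f≋f′ g n = sumTo-cong (suc n) (λ i → *-congʳ (f≋f′ i))

  ⊛-congʳ : ∀ f {g g′ : Series} → g ≋ g′ → f ⊛ g ≋ f ⊛ g′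
  ⊛-congʳ f g≋g′ n = sumTo-cong (suc n) (λ i → *-congˡ (g≋g′ (n ∸ i)))

  ⊛-identityˡ : ∀ f → oneS ⊛ f ≋ f
  ⊛-identityˡ f n = begin
    (oneS ⊛ f) n                                   ≈⟨ sumTo-head n _ ⟩
    1# * f n + sumTo n (λ i → 0# * f (n ∸ suc i))  ≈⟨ +-cong (*-identityˡ _) (sumTo-zero n (λ _ → zeroˡ _)) ⟩
    f n + 0#                                       ≈⟨ +-identityʳ _ ⟩
    f n                                            ∎

  ⊛-distribʳ-⊕ : ∀ f g h → (f ⊕ g) ⊛ h ≋ (f ⊛ h) ⊕ (g ⊛ h)
  ⊛-distribʳ-⊕ f g h n = trans (sumTo-cong (suc n) (λ _ → distribʳ _ _ _)) (sumTo-+ (suc n) _ _)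

  ⊛-·ʳ : ∀ f a g → f ⊛ (a · g) ≋ a · (f ⊛ g)
  ⊛-·ʳ f a g n =
    trans (sumTo-cong (suc n) (λ _ → x∙yz≈y∙xz _ _ _)) (sym (*-distribˡ-sumTo (suc n) a _))

  ⊛-interchange : ∀ (f g : Series) (B : ℕ → Series) n t →
                  (f ⊛ (λ k → (g ⊛ B k) t)) n ≈ (g ⊛ (λ s → (f ⊛ (λ k → B k s)) n)) t
  ⊛-interchange f g B n t = begin
    sumTo (suc n) (λ i → f i * sumTo (suc t) (λ j → g j * B (n ∸ i) (t ∸ j)))
      ≈⟨ sumTo-cong (suc n) (λ i → *-distribˡ-sumTo (suc t) (f i) _) ⟩
    sumTo (suc n) (λ i → sumTo (suc t) (λ j → f i * (g j * B (n ∸ i) (t ∸ j))))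
      ≈⟨ sumTo-comm (suc n) (suc t) _ ⟩
    sumTo (suc t) (λ j → sumTo (suc n) (λ i → f i * (g j * B (n ∸ i) (t ∸ j))))
      ≈⟨ sumTo-cong (suc t) (λ j → ⊛-·ʳ f (g j) (λ k → B k (t ∸ j)) n) ⟩
    sumTo (suc t) (λ j → g j * sumTo (suc n) (λ i → f i * B (n ∸ i) (t ∸ j)))
      ∎

  deriv-⊛ : ∀ f g → deriv (f ⊛ g) ≋ (deriv f ⊛ g) ⊕ (f ⊛ deriv g)
  deriv-⊛ f g n = begin
    fromℕ (suc n) * sumTo (suc (suc n)) (λ i → f i * g (suc n ∸ i))
      ≈⟨ *-distribˡ-sumTo (suc (suc n)) _ _ ⟩
    sumTo (suc (suc n)) (λ i → fromℕ (suc n) * (f i * g (suc n ∸ i)))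
      ≈⟨ sumTo-cong< (suc (suc n)) split ⟩
    sumTo (suc (suc n)) (λ i → A i + B i)
      ≈⟨ sumTo-+ (suc (suc n)) A B ⟩
    sumTo (suc (suc n)) A + sumTo (suc (suc n)) B
      ≈⟨ +-cong ΣA ΣB ⟩
    (deriv f ⊛ g) n + (f ⊛ deriv g) n
      ∎
    where
    A B : ℕ → Carrier
    A i = (fromℕ i * f i) * g (suc n ∸ i)
    B i = f i * (fromℕ (suc n ∸ i) * g (suc n ∸ i))

    split : ∀ i → i < suc (suc n) → fromℕ (suc n) * (f i * g (suc n ∸ i)) ≈ A i + B i
    split i (s≤s i≤1+n) =
      trans (*-congʳ (fromℕ-split i≤1+n)) ([a+b][xy]≈[ax]y+x[by] _ _ _ _)

    ΣA : sumTo (suc (suc n)) A ≈ (deriv f ⊛ g) n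
    ΣA = begin
      sumTo (suc (suc n)) A                  ≈⟨ sumTo-head (suc n) A ⟩
      A 0 + sumTo (suc n) (λ i → A (suc i))  ≈⟨ +-congʳ (trans (*-congʳ (zeroˡ _)) (zeroˡ _)) ⟩
      0# + sumTo (suc n) (λ i → A (suc i))   ≈⟨ +-identityˡ _ ⟩
      (deriv f ⊛ g) n                        ∎

    ΣB : sumTo (suc (suc n)) B ≈ (f ⊛ deriv g) n
    ΣB = begin
      sumTo (suc n) B + B (suc n)  ≈⟨ +-congˡ lastB ⟩
      sumTo (suc n) B + 0#         ≈⟨ +-identityʳ _ ⟩
      sumTo (suc n) B              ≈⟨ sumTo-cong< (suc n) (λ i i<1+n → reflexive
                                        (≡.cong (λ k → f i * (fromℕ k * g k))
                                                (Natₚ.+-∸-assoc 1 (Natₚ.≤-pred i<1+n)))) ⟩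
      (f ⊛ deriv g) n              ∎
      where
      lastB : B (suc n) ≈ 0#
      lastB = trans (*-congˡ (trans (*-congʳ (reflexive (≡.cong fromℕ (Natₚ.n∸n≡0 n)))) (zeroˡ _)))
                    (zeroʳ _)

  module _ (invP : InvertsPositive) where

    inv*fromℕ-suc : ∀ n u → inv n * (fromℕ (suc n) * u) ≈ u
    inv*fromℕ-suc n u = begin
      inv n * (fromℕ (suc n) * u)   ≈⟨ sym (*-assoc _ _ _) ⟩
      (inv n * fromℕ (suc n)) * u   ≈⟨ *-congʳ (trans (*-comm _ _) (invP n)) ⟩
      1# * u                        ≈⟨ *-identityˡ u ⟩
      u                             ∎

    fromℕ-suc-cancel : ∀ n {u v} → fromℕ (suc n) * u ≈ fromℕ (suc n) * v → u ≈ v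
    fromℕ-suc-cancel n {u} {v} eq =
      trans (sym (inv*fromℕ-suc n u)) (trans (*-congˡ eq) (inv*fromℕ-suc n v))

    fromℕ-suc*invFact-suc : ∀ n → fromℕ (suc n) * invFact (suc n) ≈ invFact n
    fromℕ-suc*invFact-suc n = begin
      fromℕ (suc n) * (inv n * invFact n)   ≈⟨ sym (*-assoc _ _ _) ⟩
      (fromℕ (suc n) * inv n) * invFact n   ≈⟨ *-congʳ (invP n) ⟩
      1# * invFact n                        ≈⟨ *-identityˡ _ ⟩
      invFact n                             ∎

    fact*invFact : ∀ n → fact n * invFact n ≈ 1#
    fact*invFact zero    = *-identityˡ 1#
    fact*invFact (suc n) = begin
      (fromℕ (suc n) * fact n) * (inv n * invFact n)   ≈⟨ *-interchange _ _ _ _ ⟩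
      (fromℕ (suc n) * inv n) * (fact n * invFact n)   ≈⟨ *-cong (invP n) (fact*invFact n) ⟩
      1# * 1#                                          ≈⟨ *-identityˡ 1# ⟩
      1#                                               ∎

    deriv-expS : deriv expS ≋ expS
    deriv-expS = fromℕ-suc*invFact-suc

    recurrence-unique : ∀ (r : ℕ → Carrier) {u v : Series} → u 0 ≈ v 0 →
                        (∀ n → deriv u n ≈ r n * u n) → (∀ n → deriv v n ≈ r n * v n) → u ≋ v
    recurrence-unique r u₀≈v₀ du dv zero    = u₀≈v₀
    recurrence-unique r u₀≈v₀ du dv (suc n) = fromℕ-suc-cancel n
      (trans (du n) (trans (*-congˡ (recurrence-unique r u₀≈v₀ du dv n)) (sym (dv n))))

    module _ (lam : Carrier) where

      falling-0 : ∀ k → falling lam (suc k) 0# ≈ 0#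
      falling-0 zero    = begin
        1# * (0# - 0# * lam)  ≈⟨ *-identityˡ _ ⟩
        0# - 0# * lam         ≈⟨ +-congˡ (-‿cong (zeroˡ lam)) ⟩
        0# - 0#               ≈⟨ -‿inverseʳ 0# ⟩
        0#                    ∎
      falling-0 (suc k) = trans (*-congʳ (falling-0 k)) (zeroˡ _)

      -- e_λ^x(t) = Σ (x)_{n,λ} tⁿ/n!; in particular eλ' lam is definitionally eλˣ 1#.
      eλˣ : Carrier → Series
      eλˣ x n = falling lam n x * invFact n

      eλˣ-0 : eλˣ 0# ≋ oneS
      eλˣ-0 zero    = *-identityˡ 1#
      eλˣ-0 (suc k) = trans (*-congʳ (falling-0 k)) (zeroˡ _)

      deriv-eλˣ : ∀ x n → deriv (eλˣ x) n ≈ (x - fromℕ n * lam) * eλˣ x n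
      deriv-eλˣ x n = begin
        fromℕ (suc n) * ((falling lam n x * a) * invFact (suc n))   ≈⟨ *-congˡ (xy∙z≈y∙xz _ _ _) ⟩
        fromℕ (suc n) * (a * (falling lam n x * invFact (suc n)))   ≈⟨ x∙yz≈y∙xz _ _ _ ⟩
        a * (fromℕ (suc n) * (falling lam n x * invFact (suc n)))   ≈⟨ *-congˡ (x∙yz≈y∙xz _ _ _) ⟩
        a * (falling lam n x * (fromℕ (suc n) * invFact (suc n)))   ≈⟨ *-congˡ (*-congˡ (fromℕ-suc*invFact-suc n)) ⟩
        a * eλˣ x n                                                 ∎
        where a = x - fromℕ n * lam

      eλˣ-+ : ∀ x y → eλˣ x ⊛ eλˣ y ≋ eλˣ (x + y)
      eλˣ-+ x y = recurrence-unique r initial recurrence (deriv-eλˣ (x + y))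
        where
        r : ℕ → Carrier
        r n = (x + y) - fromℕ n * lam

        initial : (eλˣ x ⊛ eλˣ y) 0 ≈ eλˣ (x + y) 0
        initial = trans (+-identityˡ _) (*-cong (*-identityˡ 1#) (*-identityˡ 1#))

        term : ∀ n i → i < suc n →
               deriv (eλˣ x) i * eλˣ y (n ∸ i) + eλˣ x i * deriv (eλˣ y) (n ∸ i)
                 ≈ r n * (eλˣ x i * eλˣ y (n ∸ i))
        term n i (s≤s i≤n) = begin
          deriv (eλˣ x) i * eλˣ y (n ∸ i) + eλˣ x i * deriv (eλˣ y) (n ∸ i)
            ≈⟨ +-cong (*-congʳ (deriv-eλˣ x i)) (*-congˡ (deriv-eλˣ y (n ∸ i))) ⟩
          ((x - fromℕ i * lam) * eλˣ x i) * eλˣ y (n ∸ i)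
            + eλˣ x i * ((y - fromℕ (n ∸ i) * lam) * eλˣ y (n ∸ i))
            ≈⟨ sym ([a+b][xy]≈[ax]y+x[by] _ _ _ _) ⟩
          ((x - fromℕ i * lam) + (y - fromℕ (n ∸ i) * lam)) * (eλˣ x i * eλˣ y (n ∸ i))
            ≈⟨ *-congʳ ([x-al]+[y-bl]≈[x+y]-[a+b]l x y _ _ lam) ⟩
          ((x + y) - (fromℕ i + fromℕ (n ∸ i)) * lam) * (eλˣ x i * eλˣ y (n ∸ i))
            ≈⟨ *-congʳ (+-congˡ (-‿cong (*-congʳ (sym (fromℕ-split i≤n))))) ⟩
          r n * (eλˣ x i * eλˣ y (n ∸ i))
            ∎

        recurrence : ∀ n → deriv (eλˣ x ⊛ eλˣ y) n ≈ r n * (eλˣ x ⊛ eλˣ y) n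
        recurrence n = begin
          deriv (eλˣ x ⊛ eλˣ y) n
            ≈⟨ deriv-⊛ (eλˣ x) (eλˣ y) n ⟩
          (deriv (eλˣ x) ⊛ eλˣ y) n + (eλˣ x ⊛ deriv (eλˣ y)) n
            ≈⟨ sym (sumTo-+ (suc n) _ _) ⟩
          sumTo (suc n) (λ i → deriv (eλˣ x) i * eλˣ y (n ∸ i) + eλˣ x i * deriv (eλˣ y) (n ∸ i))
            ≈⟨ sumTo-cong< (suc n) (term n) ⟩
          sumTo (suc n) (λ i → r n * (eλˣ x i * eλˣ y (n ∸ i)))
            ≈⟨ sym (*-distribˡ-sumTo (suc n) _ _) ⟩
          r n * (eλˣ x ⊛ eλˣ y) n
            ∎

      oneS⊕eλm1≋eλ : oneS ⊕ eλm1 lam ≋ eλ' lam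
      oneS⊕eλm1≋eλ n = trans (sym (+-assoc _ _ _)) (xyx⁻¹≈y (oneS n) (eλ' lam n))

      deriv-genBell : ∀ t k → deriv (λ k → genBell lam k t) k ≈ (eλm1 lam ⊛ genBell lam k) t
      deriv-genBell t k = begin
        fromℕ (suc k) * (invFact (suc k) * (D ⊛ (D ^S k)) t)   ≈⟨ sym (*-assoc _ _ _) ⟩
        (fromℕ (suc k) * invFact (suc k)) * (D ⊛ (D ^S k)) t   ≈⟨ *-congʳ (fromℕ-suc*invFact-suc k) ⟩
        invFact k * (D ⊛ (D ^S k)) t                           ≈⟨ sym (⊛-·ʳ D (invFact k) (D ^S k) t) ⟩
        (D ⊛ genBell lam k) t                                  ∎
        where D = eλm1 lam

      -- expBell n t is the coefficient of xⁿ tᵗ in eˣ · e^{x(e_λ(t)−1)}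
      expBell : ℕ → Series
      expBell n t = (expS ⊛ (λ k → genBell lam k t)) n

      expBell-suc : ∀ n → fromℕ (suc n) · expBell (suc n) ≋ eλ' lam ⊛ expBell n
      expBell-suc n t = begin
        deriv (expS ⊛ G) n
          ≈⟨ deriv-⊛ expS G n ⟩
        (deriv expS ⊛ G) n + (expS ⊛ deriv G) n
          ≈⟨ +-cong (⊛-congˡ deriv-expS G n) (⊛-congʳ expS (deriv-genBell t) n) ⟩
        expBell n t + (expS ⊛ (λ k → (eλm1 lam ⊛ genBell lam k) t)) n
          ≈⟨ +-cong (sym (⊛-identityˡ (expBell n) t)) (⊛-interchange expS (eλm1 lam) (genBell lam) n t) ⟩
        (oneS ⊛ expBell n) t + (eλm1 lam ⊛ expBell n) t
          ≈⟨ sym (⊛-distribʳ-⊕ oneS (eλm1 lam) (expBell n) t) ⟩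
        ((oneS ⊕ eλm1 lam) ⊛ expBell n) t
          ≈⟨ ⊛-congˡ oneS⊕eλm1≋eλ (expBell n) t ⟩
        (eλ' lam ⊛ expBell n) t
          ∎
        where
        G : Series
        G k = genBell lam k t

      expBell-closed : ∀ n → expBell n ≋ invFact n · eλˣ (fromℕ n)
      expBell-closed zero    t = begin
        0# + 1# * (1# * oneS t)   ≈⟨ +-identityˡ _ ⟩
        1# * (1# * oneS t)        ≈⟨ *-congˡ (*-identityˡ _) ⟩
        1# * oneS t               ≈⟨ *-congˡ (sym (eλˣ-0 t)) ⟩
        1# * eλˣ 0# t             ∎
      expBell-closed (suc n) t = fromℕ-suc-cancel n (begin
        fromℕ (suc n) * expBell (suc n) t
          ≈⟨ expBell-suc n t ⟩
        (eλˣ 1# ⊛ expBell n) t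
          ≈⟨ ⊛-congʳ (eλˣ 1#) (expBell-closed n) t ⟩
        (eλˣ 1# ⊛ (invFact n · eλˣ (fromℕ n))) t
          ≈⟨ ⊛-·ʳ (eλˣ 1#) (invFact n) (eλˣ (fromℕ n)) t ⟩
        invFact n * (eλˣ 1# ⊛ eλˣ (fromℕ n)) t
          ≈⟨ *-congˡ (eλˣ-+ 1# (fromℕ n) t) ⟩
        invFact n * eλˣ (fromℕ (suc n)) t
          ≈⟨ *-congʳ (sym (fromℕ-suc*invFact-suc n)) ⟩
        (fromℕ (suc n) * invFact (suc n)) * eλˣ (fromℕ (suc n)) t
          ≈⟨ *-assoc _ _ _ ⟩
        fromℕ (suc n) * (invFact (suc n) * eλˣ (fromℕ (suc n)) t)
          ∎)

      expS⊛φ : ∀ p n → (expS ⊛ φ lam p) n ≈ falling lam p (fromℕ n) * invFact n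
      expS⊛φ p n = begin
        (expS ⊛ (fact p · (λ k → genBell lam k p))) n   ≈⟨ ⊛-·ʳ expS (fact p) (λ k → genBell lam k p) n ⟩
        fact p * expBell n p                            ≈⟨ *-congˡ (expBell-closed n p) ⟩
        fact p * (invFact n * (a * invFact p))          ≈⟨ x∙yz≈y∙xz _ _ _ ⟩
        invFact n * (fact p * (a * invFact p))          ≈⟨ *-congˡ (x∙yz≈y∙xz _ _ _) ⟩
        invFact n * (a * (fact p * invFact p))          ≈⟨ *-congˡ (*-congˡ (fact*invFact p)) ⟩
        invFact n * (a * 1#)                            ≈⟨ *-congˡ (*-identityʳ a) ⟩
        invFact n * a                                   ≈⟨ *-comm _ _ ⟩
        a * invFact n                                   ∎
        where a = falling lam p (fromℕ n)

      fallingSum : ℕ → ℕ → Carrier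
      fallingSum p m = sumTo m (λ j → falling lam p (fromℕ (suc j)))

      y-suc : ∀ p m → y lam p (suc m) ≈ fallingSum p m * invFact (suc m)
      y-suc p zero    = sym (zeroˡ _)
      y-suc p (suc m) = refl

      deriv-y : ∀ p n → deriv (y lam p) n ≈ fallingSum p n * invFact n
      deriv-y p n = begin
        fromℕ (suc n) * y lam p (suc n)                      ≈⟨ *-congˡ (y-suc p n) ⟩
        fromℕ (suc n) * (fallingSum p n * invFact (suc n))   ≈⟨ x∙yz≈y∙xz _ _ _ ⟩
        fallingSum p n * (fromℕ (suc n) * invFact (suc n))   ≈⟨ *-congˡ (fromℕ-suc*invFact-suc n) ⟩
        fallingSum p n * invFact n                           ∎

      deriv-y⊖y : ∀ q n → (deriv (y lam (suc q)) ⊖ y lam (suc q)) n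
                          ≈ falling lam (suc q) (fromℕ n) * invFact n
      deriv-y⊖y q zero    = begin
        deriv (y lam (suc q)) 0 - 0#   ≈⟨ +-congʳ (trans (deriv-y (suc q) 0) (zeroˡ _)) ⟩
        0# - 0#                        ≈⟨ -‿inverseʳ 0# ⟩
        0#                             ≈⟨ sym (trans (*-congʳ (falling-0 q)) (zeroˡ _)) ⟩
        falling lam (suc q) 0# * 1#    ∎
      deriv-y⊖y q (suc m) = begin
        deriv (y lam p) (suc m) - y lam p (suc m)
          ≈⟨ +-cong (deriv-y p (suc m)) (-‿cong (y-suc p m)) ⟩
        (fallingSum p m + a) * invFact (suc m) - fallingSum p m * invFact (suc m)
          ≈⟨ +-congʳ (distribʳ _ _ _) ⟩
        (fallingSum p m * invFact (suc m) + a * invFact (suc m)) - fallingSum p m * invFact (suc m)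
          ≈⟨ xyx⁻¹≈y _ _ ⟩
        a * invFact (suc m)
          ∎
        where
        p = suc q
        a = falling lam p (fromℕ (suc m))

proposition3 : ∀ {c ℓ : Level} (R : CommutativeRing c ℓ)
                 (inv : ℕ → CommutativeRing.Carrier R) →
                 Series.InvertsPositive R inv →
                 (lam : CommutativeRing.Carrier R) (p : ℕ) → p ≥ 1 →
                 Series._≋_ R inv
                   (Series._⊖_ R inv (Series.deriv R inv (Series.y R inv lam p)) (Series.y R inv lam p))
                   (Series._⊛_ R inv (Series.expS R inv) (Series.φ R inv lam p))
proposition3 R inv invP lam (suc q) _ n =
  trans (deriv-y⊖y R inv invP lam q n) (sym (expS⊛φ R inv invP lam (suc q) n))
  where open CommutativeRing R using (trans; sym)
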